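{- Let $n,p,r$ be positive integers with $p\mid r$, and let $\alpha\neq\beta$ be integers. If $q>1$ is a common divisor of $r/p$, $(n-1)\alpha p-n$ and $(n-1)\beta p-n$, and $\gcd(\beta-\alpha,q)=1$, then $q$ divides $\gcd(n,p,r/p)$. -}

module Defs where

module Submission where

-- Write a = (n - 1)p, so the two hypotheses say that q divides
-- the values a·α - n and a·β - n of the integer affine map x ↦ a·x - n.
-- Their difference is a·(β - α); as q is coprime to β - α, q divides a,
-- hence q divides a·α - (a·α - n) = n.  Finally
-- p = n·p - (n - 1)·p = n·p - a is divisible by q as well.

open import Defs
open import Data.Nat using (ℕ; NonZero; _>_; _/_)
open import Data.Nat.GCD using (gcd; gcd-greatest; gcd-comm)
open import Data.Nat.Divisibility using () renaming (_∣_ to _∣ℕ_)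
open import Data.Nat.Coprimality using (gcd≡1⇒coprime)
open import Data.Integer using (ℤ; +_; _-_; _*_; ∣_∣)
open import Data.Integer.Divisibility using (_∣_)
open import Data.Integer.Divisibility.Signed as Signed
  using (∣ᵤ⇒∣; ∣⇒∣ᵤ; ∣m∣n⇒∣m-n; ∣m⇒∣m*n)
open import Data.Integer.Coprimality using (Coprime; coprime-divisor)
open import Data.Integer.Properties using (*-comm)
open import Data.Integer.Tactic.RingSolver using (solve-∀)
open import Data.Product using (_×_; _,_; proj₁; proj₂)
open import Relation.Binary.PropositionalEquality using (_≡_; _≢_; subst; trans)

∣-resp-≡ : ∀ {i m n} → m ≡ n → i Signed.∣ m → i Signed.∣ n
∣-resp-≡ {i} = subst (i Signed.∣_)

coprime-cancel : ∀ i m k → Coprime i k → i Signed.∣ m * k → i Signed.∣ m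
coprime-cancel i m k cop i∣mk =
  ∣ᵤ⇒∣ (coprime-divisor i k m cop (∣⇒∣ᵤ (∣-resp-≡ (*-comm m k) i∣mk)))

divisor-of-two-values : ∀ i a N x y → Coprime i (y - x) →
  i Signed.∣ a * x - N → i Signed.∣ a * y - N →
  i Signed.∣ a × i Signed.∣ N
divisor-of-two-values i a N x y cop i∣ax-N i∣ay-N = i∣a , i∣N
  where
  difference : ∀ a N x y → (a * y - N) - (a * x - N) ≡ a * (y - x)
  difference = solve-∀

  constant : ∀ a N x → a * x - (a * x - N) ≡ N
  constant = solve-∀

  i∣a : i Signed.∣ a
  i∣a = coprime-cancel i a (y - x) cop
          (∣-resp-≡ (difference a N x y) (∣m∣n⇒∣m-n i∣ay-N i∣ax-N))

  i∣N : i Signed.∣ N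
  i∣N = ∣-resp-≡ (constant a N x) (∣m∣n⇒∣m-n (∣m⇒∣m*n x i∣a) i∣ax-N)

divides-factor : ∀ i N P → i Signed.∣ N → i Signed.∣ (N - + 1) * P → i Signed.∣ P
divides-factor i N P i∣N i∣[N-1]P =
  ∣-resp-≡ (split N P) (∣m∣n⇒∣m-n (∣m⇒∣m*n P i∣N) i∣[N-1]P)
  where
  split : ∀ N P → N * P - (N - + 1) * P ≡ P
  split = solve-∀

-- The hypotheses of the theorem have the shape c·x·P - N; regroup them as
-- values (c·P)·x - N of an affine map with slope c·P.
regroup : ∀ c x P N → c * x * P - N ≡ (c * P) * x - N
regroup = solve-∀

lemma3p5 : (n p r : ℕ) → .{{_ : NonZero n}} → .{{_ : NonZero p}} → .{{_ : NonZero r}} →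
    p ∣ℕ r → (α β : ℤ) → α ≢ β → (q : ℕ) → q > 1 →
    q ∣ℕ (r / p) →
    (+ q) ∣ ((+ n - + 1) * α * (+ p) - (+ n)) →
    (+ q) ∣ ((+ n - + 1) * β * (+ p) - (+ n)) →
    gcd ∣ β - α ∣ q ≡ 1 →
    q ∣ℕ gcd n (gcd p (r / p))
lemma3p5 n p r _ α β _ q _ q∣r/p q∣atα q∣atβ gcd≡1 =
  gcd-greatest (∣⇒∣ᵤ q∣n) (gcd-greatest (∣⇒∣ᵤ q∣p) q∣r/p)
  where
  c = + n - + 1

  value-at : ∀ x → (+ q) ∣ c * x * + p - + n → (+ q) Signed.∣ (c * + p) * x - + n
  value-at x q∣ = ∣-resp-≡ (regroup c x (+ p) (+ n)) (∣ᵤ⇒∣ q∣)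

  q⊥β-α : Coprime (+ q) (β - α)
  q⊥β-α = gcd≡1⇒coprime (trans (gcd-comm q ∣ β - α ∣) gcd≡1)

  q∣slope×n : (+ q) Signed.∣ c * + p × (+ q) Signed.∣ + n
  q∣slope×n = divisor-of-two-values (+ q) (c * + p) (+ n) α β q⊥β-α
                (value-at α q∣atα) (value-at β q∣atβ)

  q∣n : (+ q) Signed.∣ + n
  q∣n = proj₂ q∣slope×n

  q∣p : (+ q) Signed.∣ + p
  q∣p = divides-factor (+ q) (+ n) (+ p) q∣n (proj₁ q∣slope×n)
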